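{- Let $(D,\sqsubseteq,\oplus,\mathcal B)$ be an interpretation monoid with basis semantics for elementary commands as described in the context. For all regular commands $r,r_1,r_2$ and all $d\in D$: (1) $[\![r_1+r_2]\!]d=\big([\![r_1]\!]\,\oplus^{+}\,[\![r_2]\!]\big)(d)$; (2) $[\![r^*]\!]d=\big(\bigoplus^{+}_{i\ge0}[\![r^i]\!]\big)(d)$.
   Context: Let $(D,\sqsubseteq)$ be a complete lattice with join $\sqcup$, bottom $\bot$. A (join) basis is $\mathcal B\subseteq D$ with $d=\bigsqcup\mathcal B_d$ for all $d$, where $\mathcal B_d=\{b\in\mathcal B\mid b\sqsubseteq d\}$; pointed if $\bot\in\mathcal B$. For $X\subseteq D$, $\downarrow X=\{d\mid\exists x\in X.\ d\sqsubseteq x\}$; weight $w(d)=\min\{|Y|:Y\subseteq\mathcal B_d,\downarrow Y=\downarrow\mathcal B_d\}$, $w(X)=\sup_{d\in X}w(d)$. A complete monoid $(M,\oplus)$ assigns to every family $(m_i)_{i\in I}$ ($I$ arbitrary) an element $\bigoplus_{i\in I}m_i$ with $\bigoplus_{i\in\{j\}}m_i=m_j$ and $\bigoplus_{i\in I}m_i=\bigoplus_{j\in J}\bigoplus_{i\in I_j}m_i$ for every partition $(I_j)_{j\in J}$ of $I$; $0_\oplus$ is the empty sum. $\langle S\rangle$ is the least complete submonoid containing $S$. An ordered complete monoid is a complete monoid with a partial order for which $\oplus$ is monotone. For a cardinal $\kappa$, a $\kappa$-quantale is an ordered complete monoid in which every subset of cardinality $\le\kappa$ has a join and $\bigoplus_{i\in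 I}\bigsqcup_{j\in J_i}x_{i,j}=\bigsqcup_{\beta}\bigoplus_{i\in I}x_{i,\beta(i)}$ for all index sets $I$ and nonempty $J_i$ with $|J_i|\le\kappa$ ($\beta(i)\in J_i$; right-hand join required to exist). An interpretation monoid $(D,\sqsubseteq,\oplus,\mathcal B)$: $(D,\sqsubseteq,\oplus)$ ordered complete monoid, $(D,\sqsubseteq)$ complete lattice, $\mathcal B$ pointed basis, $\langle\mathcal B\rangle$ a $\kappa_D$-quantale with $\kappa_D=w(\langle\mathcal B\rangle)$. Commands and semantics. $r::=e\mid r;r\mid r+r\mid r^*$ over elementary commands including $\mathsf0,\mathsf1$; $r^0=\mathsf1$, $r^{i+1}=r;r^i$. For $f:\mathcal B\to D$, $f^+(d)=\bigsqcup_{b\in\mathcal B_d}f(b)$. Each elementary $e$ has a monotone $[\![e]\!]_{\mathcal B}:\mathcal B\to\langle\mathcal B\rangle$ with $[\![\mathsf0]\!]_{\mathcal B}b=0_\oplus$, $[\![\mathsf1]\!]_{\mathcal B}b=b$; $[\![r_1;r_2]\!]_{\mathcal B}b=([\![r_2]\!]_{\mathcal B})^+([\![r_1]\!]_{\mathcal B}b)$, $[\![r_1+r_2]\!]_{\mathcal B}b=[\![r_1]\!]_{\mathcal B}b\oplus[\![r_2]\!]_{\mathcal B}b$, $[\![r^*]\!]_{\mathcal B}b=\bigoplus_{i\ge0}[\![r^i]\!]_{\mathcal B}b$; full semantics $[\![r]\!]=([\![r]\!]_{\mathcal B})^+:D\to D$. Additive combination: for a family of functions $f_i:D\to D$ ($i\in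 I$), $\big(\bigoplus^{+}_{i\in I}f_i\big)(d)=\bigsqcup_{b\in\mathcal B_d}\bigoplus_{i\in I}f_i(b)$; $f_1\oplus^{+}f_2$ denotes the case of a two-element family. -}

module Defs where

open import Level using (Level; suc; Lift; lift)
open import Data.Product using (Σ; Σ-syntax; ∃; _×_; _,_; proj₁)
open import Data.Empty using (⊥)
open import Data.Bool using (Bool; true; false)
open import Data.Nat using (ℕ; zero) renaming (suc to sucℕ)
open import Function.Bundles using (_↣_)
open import Relation.Binary.PropositionalEquality using (_≡_)

record RawIM (ℓ : Level) : Set (suc ℓ) where
  field
    D    : Set ℓ
    _⊑_  : D → D → Set ℓ
    ⨆    : (D → Set ℓ) → D
    ⨁    : (I : Set ℓ) → (I → D) → D
    𝓑    : D → Set ℓ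

module RawOps {ℓ : Level} (R : RawIM ℓ) where
  open RawIM R public

  bot : D
  bot = ⨆ (λ _ → Lift ℓ ⊥)

  zero⊕ : D
  zero⊕ = ⨁ (Lift ℓ ⊥) (λ ())

  _⊕_ : D → D → D
  x ⊕ y = ⨁ (Lift ℓ Bool) (λ { (lift true) → x ; (lift false) → y })

  𝓑≤ : D → D → Set ℓ
  𝓑≤ d b = 𝓑 b × (b ⊑ d)

  ↓ : (D → Set ℓ) → D → Set ℓ
  ↓ X e = Σ[ x ∈ D ] (X x × (e ⊑ x))

  -- least complete submonoid ⟨𝓑⟩ containing 𝓑 (inductive closure under all sums)
  data Gen : D → Set (suc ℓ) where
    base : ∀ {d} → 𝓑 d → Gen d
    sum  : (I : Set ℓ) (m : I → D) → (∀ i → Gen (m i)) → Gen (⨁ I m)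

  Covers : D → (D → Set ℓ) → Set ℓ
  Covers d Y = (∀ y → Y y → 𝓑≤ d y)
             × (∀ e → (↓ Y e → ↓ (𝓑≤ d) e) × (↓ (𝓑≤ d) e → ↓ Y e))

  -- |J| ≤ κ_D = w(⟨𝓑⟩) = sup_{d ∈ ⟨𝓑⟩} min{ |Y| : Covers d Y }.
  -- Encoded: |J| is below every cardinal |Λ| that bounds all w(d), d ∈ ⟨𝓑⟩,
  -- where w(d) ≤ |Λ| iff some covering Y injects into Λ.
  Smallκ : Set ℓ → Set (suc ℓ)
  Smallκ J = (Λ : Set ℓ) →
             (∀ d → Gen d → Σ[ Y ∈ (D → Set ℓ) ] (Covers d Y × (Σ D Y ↣ Λ))) →
             J ↣ Λ

  IsJoinIn : ∀ {a} → (D → Set a) → {J : Set ℓ} → (J → D) → D → Set (a Level.⊔ ℓ)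
  IsJoinIn P {J} x u = P u × (∀ j → x j ⊑ u)
                       × (∀ v → P v → (∀ j → x j ⊑ v) → u ⊑ v)

  _⁺ : (D → D) → D → D
  (f ⁺) d = ⨆ (λ y → Σ[ b ∈ D ] (𝓑≤ d b × (f b ≡ y)))

  ⨁⁺ : (I : Set ℓ) → (I → D → D) → D → D
  ⨁⁺ I f d = ⨆ (λ y → Σ[ b ∈ D ] (𝓑≤ d b × (⨁ I (λ i → f i b) ≡ y)))

  _⊕⁺_ : (D → D) → (D → D) → D → D
  (f ⊕⁺ g) d = ⨆ (λ y → Σ[ b ∈ D ] (𝓑≤ d b × ((f b ⊕ g b) ≡ y)))

record IsInterpretationMonoid {ℓ : Level} (R : RawIM ℓ) : Set (suc ℓ) where
  open RawOps R
  field
    ⊑-refl    : ∀ {x} → x ⊑ x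
    ⊑-trans   : ∀ {x y z} → x ⊑ y → y ⊑ z → x ⊑ z
    ⊑-antisym : ∀ {x y} → x ⊑ y → y ⊑ x → x ≡ y
    ⨆-upper   : ∀ (S : D → Set ℓ) x → S x → x ⊑ ⨆ S
    ⨆-least   : ∀ (S : D → Set ℓ) u → (∀ x → S x → x ⊑ u) → ⨆ S ⊑ u
    ⨁-single  : ∀ (I : Set ℓ) (c : I) → (∀ i → i ≡ c) → (m : I → D) → ⨁ I m ≡ m c
    -- complete monoid: partition associativity; a partition (I_j)_{j∈J} of I
    -- is given by the map p : I → J sending i to its block, I_j = p⁻¹(j)
    ⨁-part    : ∀ (I J : Set ℓ) (p : I → J) (m : I → D) →
                ⨁ I m ≡ ⨁ J (λ j → ⨁ (Σ[ i ∈ I ] (p i ≡ j)) (λ k → m (proj₁ k)))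
    ⨁-mono    : ∀ (I : Set ℓ) (m m' : I → D) → (∀ i → m i ⊑ m' i) → ⨁ I m ⊑ ⨁ I m'
    basis     : ∀ d → d ≡ ⨆ (𝓑≤ d)
    pointed   : 𝓑 bot
    -- ⟨𝓑⟩ is a κ_D-quantale (κ_D = w(⟨𝓑⟩)), with the order inherited from D
    q-join    : ∀ (J : Set ℓ) → Smallκ J → (x : J → D) → (∀ j → Gen (x j)) →
                Σ[ u ∈ D ] IsJoinIn Gen x u
    q-distr   : ∀ (I : Set ℓ) (J : I → Set ℓ) → (∀ i → J i) → (∀ i → Smallκ (J i)) →
                (x : (i : I) → J i → D) → (∀ i j → Gen (x i j)) →
                (y : I → D) → (∀ i → IsJoinIn Gen (x i) (y i)) →
                IsJoinIn Gen {(i : I) → J i} (λ β → ⨁ I (λ i → x i (β i))) (⨁ I y)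

record InterpretationMonoid (ℓ : Level) : Set (suc ℓ) where
  field
    raw   : RawIM ℓ
    isIM  : IsInterpretationMonoid raw

data Cmd {e : Level} (E : Set e) : Set e where
  elem : E → Cmd E
  𝟘 𝟙  : Cmd E
  _︔_ : Cmd E → Cmd E → Cmd E
  _+ᶜ_ : Cmd E → Cmd E → Cmd E
  _⋆   : Cmd E → Cmd E

pow : ∀ {e} {E : Set e} → Cmd E → ℕ → Cmd E
pow r zero     = 𝟙
pow r (sucℕ i) = r ︔ pow r i

record ElemSem {ℓ e : Level} (R : RawIM ℓ) (E : Set e) : Set (suc ℓ Level.⊔ e) where
  open RawOps R
  field
    ⟦_⟧ₑ     : E → D → D     -- only its values on basis elements matter
    ⟦⟧ₑ-mono : ∀ c {b b'} → 𝓑 b → 𝓑 b' → b ⊑ b' → ⟦ c ⟧ₑ b ⊑ ⟦ c ⟧ₑ b'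
    ⟦⟧ₑ-gen  : ∀ c {b} → 𝓑 b → Gen (⟦ c ⟧ₑ b)

module Semantics {ℓ e : Level} (R : RawIM ℓ) {E : Set e} (S : ElemSem R E) where
  open RawOps R
  open ElemSem S

  -- powers of a basis semantics: f⁰ b = b, f^{i+1} b = (fⁱ)⁺ (f b),
  -- i.e. exactly ⟦rⁱ⟧_𝓑 when f = ⟦r⟧_𝓑 (r⁰ = 𝟙, r^{i+1} = r ; rⁱ)
  powSem : (D → D) → ℕ → D → D
  powSem f zero     b = b
  powSem f (sucℕ i) b = (powSem f i ⁺) (f b)

  ⟦_⟧𝓑 : Cmd E → D → D
  ⟦ elem c ⟧𝓑 b   = ⟦ c ⟧ₑ b
  ⟦ 𝟘 ⟧𝓑 b        = zero⊕
  ⟦ 𝟙 ⟧𝓑 b        = b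
  ⟦ r₁ ︔ r₂ ⟧𝓑 b  = (⟦ r₂ ⟧𝓑 ⁺) (⟦ r₁ ⟧𝓑 b)
  ⟦ r₁ +ᶜ r₂ ⟧𝓑 b = ⟦ r₁ ⟧𝓑 b ⊕ ⟦ r₂ ⟧𝓑 b
  ⟦ r ⋆ ⟧𝓑 b      = ⨁ (Lift ℓ ℕ) (λ { (lift i) → powSem ⟦ r ⟧𝓑 i b })

  ⟦_⟧ : Cmd E → D → D
  ⟦ r ⟧ = ⟦ r ⟧𝓑 ⁺

{-# OPTIONS --safe #-}
module Submission where

-- Every ⟦ r ⟧𝓑 is monotone on the basis, and a function monotone on the basis
-- agrees there with its extension f⁺ (b is the greatest basis element below b).
-- Hence inside the joins defining ⟦ r₁ +ᶜ r₂ ⟧ and ⟦ r ⋆ ⟧ one may replace each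
-- ⟦ rᵢ ⟧𝓑 b by ⟦ rᵢ ⟧ b, which is exactly the additive combination.

open import Defs
open import Level using (Level; Lift; lower; lift)
open import Data.Nat using (ℕ; zero) renaming (suc to sucℕ)
open import Data.Bool using (true; false)
open import Data.Product using (_×_; _,_)
open import Relation.Binary.PropositionalEquality using (_≡_; refl; sym; trans; cong₂; subst)

module Extension {ℓ : Level} {R : RawIM ℓ} (IM : IsInterpretationMonoid R) where
  open RawOps R
  open IsInterpretationMonoid IM

  MonotoneOn𝓑 : (D → D) → Set ℓ
  MonotoneOn𝓑 f = ∀ {b b'} → 𝓑 b → 𝓑 b' → b ⊑ b' → f b ⊑ f b'

  ≡⇒⊑ : ∀ {x y} → x ≡ y → x ⊑ y
  ≡⇒⊑ refl = ⊑-refl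

  ⨁-cong : ∀ (I : Set ℓ) {m m' : I → D} → (∀ i → m i ≡ m' i) → ⨁ I m ≡ ⨁ I m'
  ⨁-cong I {m} {m'} m≡m' = ⊑-antisym (⨁-mono I m m' (λ i → ≡⇒⊑ (m≡m' i)))
                                     (⨁-mono I m' m (λ i → ≡⇒⊑ (sym (m≡m' i))))

  ⊕-mono : ∀ {x x' y y'} → x ⊑ x' → y ⊑ y' → (x ⊕ y) ⊑ (x' ⊕ y')
  ⊕-mono x⊑x' y⊑y' = ⨁-mono _ _ _ λ { (lift true) → x⊑x' ; (lift false) → y⊑y' }

  ⁺-mono : ∀ (f : D → D) {x y} → x ⊑ y → (f ⁺) x ⊑ (f ⁺) y
  ⁺-mono f x⊑y = ⨆-least _ _ λ { z (b , (b∈𝓑 , b⊑x) , fb≡z) →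
    ⨆-upper _ z (b , (b∈𝓑 , ⊑-trans b⊑x x⊑y) , fb≡z) }

  ⁺-extends : ∀ {f : D → D} → MonotoneOn𝓑 f → ∀ {b} → 𝓑 b → (f ⁺) b ≡ f b
  ⁺-extends {f} f-mono {b} b∈𝓑 = ⊑-antisym
    (⨆-least _ _ λ { z (b' , (b'∈𝓑 , b'⊑b) , fb'≡z) →
      subst (_⊑ f b) fb'≡z (f-mono b'∈𝓑 b∈𝓑 b'⊑b) })
    (⨆-upper _ (f b) (b , (b∈𝓑 , ⊑-refl) , refl))

  -- (f ⊕⁺ g) d and ⨁⁺ I f d unfold to (h ⁺) d for the pointwise sum h,
  -- so this lemma also rewrites inside additive combinations.
  ⁺-cong-𝓑≤ : ∀ d {f g : D → D} → (∀ b → 𝓑≤ d b → f b ≡ g b) → (f ⁺) d ≡ (g ⁺) d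
  ⁺-cong-𝓑≤ d f≡g = ⊑-antisym
    (⨆-least _ _ λ { z (b , b∈𝓑d , fb≡z) →
      ⨆-upper _ z (b , b∈𝓑d , trans (sym (f≡g b b∈𝓑d)) fb≡z) })
    (⨆-least _ _ λ { z (b , b∈𝓑d , gb≡z) →
      ⨆-upper _ z (b , b∈𝓑d , trans (f≡g b b∈𝓑d) gb≡z) })

module CommandSemantics {ℓ e : Level} (M : InterpretationMonoid ℓ) {E : Set e}
                        (S : ElemSem (InterpretationMonoid.raw M) E) where
  open InterpretationMonoid M
  open RawOps raw
  open Semantics raw S
  open ElemSem S
  open IsInterpretationMonoid isIM
  open Extension isIM

  powSem-monotoneOn𝓑 : ∀ {f} → MonotoneOn𝓑 f → ∀ i → MonotoneOn𝓑 (powSem f i)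
  powSem-monotoneOn𝓑 f-mono zero     _   _    b⊑b' = b⊑b'
  powSem-monotoneOn𝓑 f-mono (sucℕ i) b∈𝓑 b'∈𝓑 b⊑b' =
    ⁺-mono (powSem _ i) (f-mono b∈𝓑 b'∈𝓑 b⊑b')

  ⟦⟧𝓑-monotoneOn𝓑 : ∀ r → MonotoneOn𝓑 ⟦ r ⟧𝓑
  ⟦⟧𝓑-monotoneOn𝓑 (elem c)    = ⟦⟧ₑ-mono c
  ⟦⟧𝓑-monotoneOn𝓑 𝟘           _ _ _ = ⊑-refl
  ⟦⟧𝓑-monotoneOn𝓑 𝟙           _ _ b⊑b' = b⊑b'
  ⟦⟧𝓑-monotoneOn𝓑 (r₁ ︔ r₂)  b∈𝓑 b'∈𝓑 b⊑b' =
    ⁺-mono ⟦ r₂ ⟧𝓑 (⟦⟧𝓑-monotoneOn𝓑 r₁ b∈𝓑 b'∈𝓑 b⊑b')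
  ⟦⟧𝓑-monotoneOn𝓑 (r₁ +ᶜ r₂) b∈𝓑 b'∈𝓑 b⊑b' =
    ⊕-mono (⟦⟧𝓑-monotoneOn𝓑 r₁ b∈𝓑 b'∈𝓑 b⊑b') (⟦⟧𝓑-monotoneOn𝓑 r₂ b∈𝓑 b'∈𝓑 b⊑b')
  ⟦⟧𝓑-monotoneOn𝓑 (r ⋆)       b∈𝓑 b'∈𝓑 b⊑b' = ⨁-mono _ _ _ λ { (lift i) →
    powSem-monotoneOn𝓑 (⟦⟧𝓑-monotoneOn𝓑 r) i b∈𝓑 b'∈𝓑 b⊑b' }

  ⟦⟧-on-𝓑 : ∀ r {b} → 𝓑 b → ⟦ r ⟧ b ≡ ⟦ r ⟧𝓑 b
  ⟦⟧-on-𝓑 r = ⁺-extends (⟦⟧𝓑-monotoneOn𝓑 r)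

  ⟦pow⟧𝓑≡powSem : ∀ r i x → ⟦ pow r i ⟧𝓑 x ≡ powSem ⟦ r ⟧𝓑 i x
  ⟦pow⟧𝓑≡powSem r zero     x = refl
  ⟦pow⟧𝓑≡powSem r (sucℕ i) x = ⁺-cong-𝓑≤ (⟦ r ⟧𝓑 x) λ b _ → ⟦pow⟧𝓑≡powSem r i b

  ⟦+ᶜ⟧≡⊕⁺ : ∀ r₁ r₂ d → ⟦ r₁ +ᶜ r₂ ⟧ d ≡ (⟦ r₁ ⟧ ⊕⁺ ⟦ r₂ ⟧) d
  ⟦+ᶜ⟧≡⊕⁺ r₁ r₂ d = ⁺-cong-𝓑≤ d λ b (b∈𝓑 , _) →
    cong₂ _⊕_ (sym (⟦⟧-on-𝓑 r₁ b∈𝓑)) (sym (⟦⟧-on-𝓑 r₂ b∈𝓑))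

  ⟦⋆⟧≡⨁⁺pow : ∀ r d → ⟦ r ⋆ ⟧ d ≡ ⨁⁺ (Lift ℓ ℕ) (λ i → ⟦ pow r (lower i) ⟧) d
  ⟦⋆⟧≡⨁⁺pow r d = ⁺-cong-𝓑≤ d λ b (b∈𝓑 , _) → ⨁-cong _ λ { (lift i) →
    sym (trans (⟦⟧-on-𝓑 (pow r i) b∈𝓑) (⟦pow⟧𝓑≡powSem r i b)) }

lemma2p15 : ∀ {ℓ e : Level} (M : InterpretationMonoid ℓ) {E : Set e}
              (S : ElemSem (InterpretationMonoid.raw M) E) →
              let open RawOps (InterpretationMonoid.raw M)
                  open Semantics (InterpretationMonoid.raw M) S
              in (∀ (r₁ r₂ : Cmd E) (d : D) → ⟦ r₁ +ᶜ r₂ ⟧ d ≡ (⟦ r₁ ⟧ ⊕⁺ ⟦ r₂ ⟧) d)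
                 × (∀ (r : Cmd E) (d : D) →
                      ⟦ r ⋆ ⟧ d ≡ ⨁⁺ (Lift ℓ ℕ) (λ i → ⟦ pow r (lower i) ⟧) d)
lemma2p15 M S = ⟦+ᶜ⟧≡⊕⁺ , ⟦⋆⟧≡⨁⁺pow
  where open CommandSemantics M S
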